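{- Let $q\ge2$, $n\ge1$. (a) Let $f=\chi^{S_1}$ and $g=\chi^{S_2}$ be two perfect $2$-colorings of $Z_q^n$ with the same matrix of parameters $\begin{pmatrix} n(q-1)-b & b\\ c & n(q-1)-c\end{pmatrix}$ and with $S_1\ne S_2$. Then the component $S=S_1\setminus S_2$ satisfies $|S|\ge 2^{\frac{c+b}{q}-1}$. (b) Let $C_1,C_2\subseteq Z_q^n$ be two distinct $1$-perfect codes. Then the component $S=C_1\setminus C_2$ satisfies $|S|\ge 2^{\frac{n(q-1)+1}{q}-1}$.
   Context: $Z_q=\{0,\dots,q-1\}$, $Z_q^n$ is the set of $n$-tuples over $Z_q$; $x,y$ are neighbors if they differ in exactly one coordinate. A perfect $2$-coloring is a function $f:Z_q^n\to\{0,1\}$ taking both values such that there are numbers $a_{ij}$ with every $x$ with $f(x)=i$ having exactly $a_{ij}$ neighbors $y$ with $f(y)=j$; the matrix $\begin{pmatrix} n(q-1)-b & b\\ c & n(q-1)-c\end{pmatrix}$ means each $x$ with $f(x)=0$ has exactly $b$ neighbors in $f^{ -1}(1)$ and each $x$ with $f(x)=1$ has exactly $c$ neighbors in $f^{ -1}(0)$. A $1$-perfect code $C\subseteq Z_q^n$ is a set such that $\chi^C$ is a perfect $2$-coloring with matrix $\begin{pmatrix} n(q-1)-1 & 1\\ n(q-1) & 0\end{pmatrix}$. If $\chi^{S_1},\chi^{S_2}$ are perfect $2$-colorings with equal matrices of parameters, the sets $S_1\setminus S_2$ and $S_2\setminus S_1$ are called components (and $S_1\triangle S_2$ a mobile set).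 -}

module Defs where

open import Data.Nat using (ℕ; zero; suc; _+_; _*_; _∸_; _^_; _≤_)
open import Data.Fin using (Fin; zero; suc)
open import Data.Fin.Properties using () renaming (_≟_ to _≟ᶠ_)
open import Data.Vec using (Vec; []; _∷_)
open import Data.List using (List; []; _∷_; map; concatMap; length; filter; allFin)
open import Data.Product using (_×_; ∃)
open import Relation.Binary.PropositionalEquality using (_≡_; _≢_)
open import Relation.Nullary using (¬_; yes; no)
open import Relation.Nullary.Decidable using (_×-dec_)
open import Data.Nat.Properties using () renaming (_≟_ to _≟ⁿ_)

Word : ℕ → ℕ → Set
Word q n = Vec (Fin q) n

allWords : (q n : ℕ) → List (Word q n)
allWords q zero = [] ∷ []
allWords q (suc n) = concatMap (λ a → map (a ∷_) (allWords q n)) (allFin q)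

dist : ∀ {q n} → Word q n → Word q n → ℕ
dist [] [] = 0
dist (a ∷ x) (b ∷ y) with a ≟ᶠ b
... | yes _ = dist x y
... | no  _ = suc (dist x y)

-- A colouring into two colours {0,1}; a subset S is represented by its characteristic function.
Coloring : ℕ → ℕ → Set
Coloring q n = Word q n → Fin 2

nbrCount : ∀ {q n} → Coloring q n → Word q n → Fin 2 → ℕ
nbrCount {q} {n} f x j =
  length (filter (λ y → (dist x y ≟ⁿ 1) ×-dec (f y ≟ᶠ j)) (allWords q n))

IsPerfect2Coloring : ∀ {q n} → Coloring q n → (Fin 2 → Fin 2 → ℕ) → Set
IsPerfect2Coloring f M =
  (∃ λ x → f x ≡ zero) × (∃ λ x → f x ≡ suc zero) ×
  (∀ x i j → f x ≡ i → nbrCount f x j ≡ M i j)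

paramMatrix : ℕ → ℕ → ℕ → ℕ → Fin 2 → Fin 2 → ℕ
paramMatrix q n b c zero zero = n * (q ∸ 1) ∸ b
paramMatrix q n b c zero (suc zero) = b
paramMatrix q n b c (suc zero) zero = c
paramMatrix q n b c (suc zero) (suc zero) = n * (q ∸ 1) ∸ c

Is1PerfectCode : ∀ {q n} → Coloring q n → Set
Is1PerfectCode {q} {n} χC = IsPerfect2Coloring χC (paramMatrix q n 1 (n * (q ∸ 1)))

diffSize : ∀ {q n} → Coloring q n → Coloring q n → ℕ
diffSize {q} {n} f g =
  length (filter (λ x → (f x ≟ᶠ suc zero) ×-dec (g x ≟ᶠ zero)) (allWords q n))

module Submission where

-- The difference h = χ(S₁) − χ(S₂) of two perfect colourings with the same parameters is an
-- eigenfunction of the Hamming graph H(n,q) with eigenvalue n(q−1) − (b+c). Since H(n,q) is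
-- connected, b + c > 0, so h is orthogonal to the constants: |S₁ ∖ S₂| = |S₂ ∖ S₁|, and
-- |supp h| = 2|S₁ ∖ S₂|. An eigenfunction with eigenvalue n(q−1) − k has support of size at least
-- 2^(k/q), by induction on n: summing h over the first coordinate gives an eigenfunction of
-- H(n−1,q) with eigenvalue (n−1)(q−1) − k and no larger support; if that sum vanishes, at least two
-- of the q slices h(a,·) are nonzero, and each is an eigenfunction of H(n−1,q) with eigenvalue
-- (n−1)(q−1) − (k−q), so the bound doubles. Part (b) is part (a) for b = 1, c = n(q−1).

open import Algebra.Bundles using (Semiring)
import Algebra.Properties.CommutativeSemigroup as CommutativeSemigroupProperties
import Algebra.Properties.Semiring.Sum as SemiringSum
open import Data.Bool using (true; false; if_then_else_)
open import Data.Empty using (⊥-elim)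
open import Data.Fin using (Fin; zero; suc)
open import Data.Fin.Properties using (any?) renaming (_≟_ to _≟ᶠ_)
open import Data.Integer using (ℤ; +_; -[1+_]; 0ℤ; 1ℤ; -1ℤ)
import Data.Integer.Properties as ℤP
open import Data.Integer.Tactic.RingSolver using (solve-∀)
open import Data.List using (List; []; _∷_; _++_; map; filter; length; concatMap; tabulate; allFin)
open import Data.List.Properties using (map-++; map-∘)
open import Data.Nat as ℕ using (ℕ; zero; suc; _≤_; _<_; _^_; z≤n; s≤s)
open import Data.Nat.ListAction using (sum)
open import Data.Nat.ListAction.Properties using (sum-++)
import Data.Nat.Properties as ℕP
open import Data.Nat.Properties using () renaming (_≟_ to _≟ⁿ_)
import Data.Nat.Tactic.RingSolver as ℕRingSolver
open import Data.Product using (∃; _×_; _,_)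
open import Data.Sum using (inj₁; inj₂; fromInj₂)
open import Data.Vec using ([]; _∷_)
open import Function using (_∘_)
open import Relation.Binary.PropositionalEquality
open import Relation.Nullary using (Dec; does; yes; no; ¬_; ¬?)
open import Relation.Nullary.Decidable using (_×-dec_)
open import Relation.Unary using (Pred; Decidable)
open import Defs

-- Defined through `does` alone, so that e.g. 𝟙 (suc d ≟ⁿ 1) and 𝟙 (d ≟ⁿ 0) are definitionally equal.
𝟙 : ∀ {a} {P : Set a} → Dec P → ℕ
𝟙 d = if does d then 1 else 0

module WordSum {c ℓ} (R : Semiring c ℓ) (q : ℕ) where
  open Semiring R using (Carrier; _≈_; _+_; _*_; 0#)
    renaming (refl to ≈-refl; sym to ≈-sym; trans to ≈-trans)
  open SemiringSum R

  ∑ʷ : ∀ {n} → (Word q n → Carrier) → Carrier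
  ∑ʷ {zero} h = h []
  ∑ʷ {suc n} h = ∑[ a < q ] ∑ʷ (λ y → h (a ∷ y))

  ∑ʷ-cong : ∀ {n} {f g : Word q n → Carrier} → (∀ x → f x ≈ g x) → ∑ʷ f ≈ ∑ʷ g
  ∑ʷ-cong {zero} f≈g = f≈g []
  ∑ʷ-cong {suc n} f≈g = sum-cong-≋ (λ a → ∑ʷ-cong (λ y → f≈g (a ∷ y)))

  ∑ʷ-distrib-+ : ∀ {n} (f g : Word q n → Carrier) →
    ∑ʷ (λ x → f x + g x) ≈ ∑ʷ f + ∑ʷ g
  ∑ʷ-distrib-+ {zero} f g = ≈-refl
  ∑ʷ-distrib-+ {suc n} f g = ≈-trans
    (sum-cong-≋ (λ a → ∑ʷ-distrib-+ (λ y → f (a ∷ y)) (λ y → g (a ∷ y))))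
    (∑-distrib-+ (λ a → ∑ʷ (λ y → f (a ∷ y))) (λ a → ∑ʷ (λ y → g (a ∷ y))))

  ∑ʷ-zero : ∀ {n} → ∑ʷ {n} (λ _ → 0#) ≈ 0#
  ∑ʷ-zero {zero} = ≈-refl
  ∑ʷ-zero {suc n} = ≈-trans (sum-cong-≋ {q} (λ _ → ∑ʷ-zero {n})) (sum-replicate-zero q)

  *-distribˡ-∑ʷ : ∀ {n} k (f : Word q n → Carrier) → ∑ʷ (λ x → k * f x) ≈ k * ∑ʷ f
  *-distribˡ-∑ʷ {zero} k f = ≈-refl
  *-distribˡ-∑ʷ {suc n} k f = ≈-trans
    (sum-cong-≋ (λ a → *-distribˡ-∑ʷ k (λ y → f (a ∷ y))))
    (≈-sym (*-distribˡ-sum k (λ a → ∑ʷ (λ y → f (a ∷ y)))))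

  ∑ʷ-comm-∑ : ∀ {n m} (F : Fin m → Word q n → Carrier) →
    ∑ʷ (λ x → ∑[ b < m ] F b x) ≈ ∑[ b < m ] ∑ʷ (F b)
  ∑ʷ-comm-∑ {zero} F = ≈-refl
  ∑ʷ-comm-∑ {suc n} F = ≈-trans
    (sum-cong-≋ (λ a → ∑ʷ-comm-∑ (λ b y → F b (a ∷ y))))
    (∑-comm (λ a b → ∑ʷ (λ y → F b (a ∷ y))))

module ℕΣ = SemiringSum ℕP.+-*-semiring

module IntegerFinSum where
  open import Data.Integer using (_+_; _*_)
  open SemiringSum ℤP.+-*-semiring

  ∑-const : ∀ {m} v → ∑[ b < m ] v ≡ + m * v
  ∑-const {zero} v = refl
  ∑-const {suc m} v = trans (cong (_+_ v) (∑-const {m} v)) (v+mv≡[1+m]v v (+ m))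
    where v+mv≡[1+m]v : ∀ v m → v + m * v ≡ (1ℤ + m) * v
          v+mv≡[1+m]v = solve-∀

  ∑-δ : ∀ {m} (a : Fin m) (u : Fin m → ℤ) → ∑[ b < m ] (+ 𝟙 (a ≟ᶠ b) * u b) ≡ u a
  ∑-δ {suc m} zero u =
    trans (cong₂ _+_ (ℤP.*-identityˡ (u zero)) (sum-replicate-zero m)) (ℤP.+-identityʳ (u zero))
  ∑-δ {suc m} (suc a) u = trans (ℤP.+-identityˡ _) (∑-δ a (u ∘ suc))

  pos-∑ : ∀ {m} (t : Fin m → ℕ) → + ℕΣ.sum t ≡ ∑[ b < m ] (+ t b)
  pos-∑ {zero} t = refl
  pos-∑ {suc m} t = trans (ℤP.pos-+ (t zero) _) (cong (_+_ (+ t zero)) (pos-∑ (t ∘ suc)))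

module NaturalFinSum where
  open import Data.Nat using (_+_)
  open ℕΣ

  ∑-mono-≤ : ∀ {m} {s t : Fin m → ℕ} → (∀ b → s b ≤ t b) →
    ∑[ b < m ] s b ≤ ∑[ b < m ] t b
  ∑-mono-≤ {zero} s≤t = z≤n
  ∑-mono-≤ {suc m} s≤t = ℕP.+-mono-≤ (s≤t zero) (∑-mono-≤ (s≤t ∘ suc))

  term≤∑ : ∀ {m} (t : Fin m → ℕ) a → t a ≤ ∑[ b < m ] t b
  term≤∑ t zero = ℕP.m≤m+n _ _
  term≤∑ t (suc a) = ℕP.≤-trans (term≤∑ (t ∘ suc) a) (ℕP.m≤n+m _ _)

  two-terms≤∑ : ∀ {m} (t : Fin m → ℕ) {a b} → a ≢ b → t a + t b ≤ ∑[ c < m ] t c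
  two-terms≤∑ t {zero} {zero} a≢b = ⊥-elim (a≢b refl)
  two-terms≤∑ t {zero} {suc b} _ = ℕP.+-monoʳ-≤ (t zero) (term≤∑ (t ∘ suc) b)
  two-terms≤∑ t {suc a} {zero} _ = subst (_≤ ∑[ c < _ ] t c) (ℕP.+-comm (t zero) (t (suc a)))
    (ℕP.+-monoʳ-≤ (t zero) (term≤∑ (t ∘ suc) a))
  two-terms≤∑ t {suc a} {suc b} a≢b =
    ℕP.≤-trans (two-terms≤∑ (t ∘ suc) (a≢b ∘ cong suc)) (ℕP.m≤n+m _ _)

  ∑-positive : ∀ {m} (t : Fin m → ℕ) → 0 < ∑[ b < m ] t b → ∃ λ a → 0 < t a
  ∑-positive {zero} t ()
  ∑-positive {suc m} t pos with t zero in t₀≡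
  ... | suc _ = zero , subst (0 <_) (sym t₀≡) (s≤s z≤n)
  ... | zero = let a , 0<t-a = ∑-positive (t ∘ suc) pos in suc a , 0<t-a

module NaturalWordSum (q : ℕ) where
  open WordSum ℕP.+-*-semiring q public
  open NaturalFinSum

  ∑ʷ-mono-≤ : ∀ {n} {s t : Word q n → ℕ} → (∀ x → s x ≤ t x) → ∑ʷ s ≤ ∑ʷ t
  ∑ʷ-mono-≤ {zero} s≤t = s≤t []
  ∑ʷ-mono-≤ {suc n} s≤t = ∑-mono-≤ (λ a → ∑ʷ-mono-≤ (λ y → s≤t (a ∷ y)))

  term≤∑ʷ : ∀ {n} (t : Word q n → ℕ) x → t x ≤ ∑ʷ t
  term≤∑ʷ t [] = ℕP.≤-refl
  term≤∑ʷ t (a ∷ x) =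
    ℕP.≤-trans (term≤∑ʷ (λ y → t (a ∷ y)) x) (term≤∑ (λ b → ∑ʷ (λ y → t (b ∷ y))) a)

  ∑ʷ≡0⇒≡0 : ∀ {n} (t : Word q n → ℕ) → ∑ʷ t ≡ 0 → ∀ x → t x ≡ 0
  ∑ʷ≡0⇒≡0 t ∑t≡0 x = ℕP.n≤0⇒n≡0 (subst (t x ≤_) ∑t≡0 (term≤∑ʷ t x))

module PowerBounds where
  open import Data.Nat using (_+_; _*_)
  open ℕP.≤-Reasoning

  ^-distrib-* : ∀ m n k → (m * n) ^ k ≡ m ^ k * n ^ k
  ^-distrib-* m n zero = refl
  ^-distrib-* m n (suc k) =
    trans (cong ((m * n) *_) (^-distrib-* m n k)) (ab[cd]≡ac[bd] m n (m ^ k) (n ^ k))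
    where ab[cd]≡ac[bd] : ∀ a b c d → a * b * (c * d) ≡ a * c * (b * d)
          ab[cd]≡ac[bd] = ℕRingSolver.solve-∀

  [m+m]^k≡2^k*m^k : ∀ m k → (m + m) ^ k ≡ 2 ^ k * m ^ k
  [m+m]^k≡2^k*m^k m k =
    trans (cong (λ t → (m + t) ^ k) (sym (ℕP.+-identityʳ m))) (^-distrib-* 2 m k)

  2^k≤[x+y]^q : ∀ {k q x y} → k ≤ q → 1 ≤ x → 1 ≤ y → 2 ^ k ≤ (x + y) ^ q
  2^k≤[x+y]^q {k} {q} {x} {y} k≤q 1≤x 1≤y = begin
    2 ^ k       ≤⟨ ℕP.^-monoʳ-≤ 2 k≤q ⟩
    2 ^ q       ≤⟨ ℕP.^-monoˡ-≤ q (ℕP.+-mono-≤ 1≤x 1≤y) ⟩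
    (x + y) ^ q ∎

  2^[q+k]≤[m+m]^q : ∀ q k m → 2 ^ k ≤ m ^ q → 2 ^ (q + k) ≤ (m + m) ^ q
  2^[q+k]≤[m+m]^q q k m 2^k≤m^q = begin
    2 ^ (q + k)   ≡⟨ ℕP.^-distribˡ-+-* 2 q k ⟩
    2 ^ q * 2 ^ k ≤⟨ ℕP.*-monoʳ-≤ (2 ^ q) 2^k≤m^q ⟩
    2 ^ q * m ^ q ≡⟨ [m+m]^k≡2^k*m^k m q ⟨
    (m + m) ^ q   ∎

  2^[q+k]≤[x+y]^q : ∀ q k x y → 2 ^ k ≤ x ^ q → 2 ^ k ≤ y ^ q → 2 ^ (q + k) ≤ (x + y) ^ q
  2^[q+k]≤[x+y]^q q k x y 2^k≤x^q 2^k≤y^q with ℕP.≤-total x y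
  ... | inj₁ x≤y =
    ℕP.≤-trans (2^[q+k]≤[m+m]^q q k x 2^k≤x^q) (ℕP.^-monoˡ-≤ q (ℕP.+-monoʳ-≤ x x≤y))
  ... | inj₂ y≤x =
    ℕP.≤-trans (2^[q+k]≤[m+m]^q q k y 2^k≤y^q) (ℕP.^-monoˡ-≤ q (ℕP.+-monoˡ-≤ y y≤x))

module ListSums where
  open import Data.Nat using (_+_)
  open ≡-Reasoning

  length-filter≡sum : ∀ {a p} {A : Set a} {P : Pred A p} (P? : Decidable P) xs →
    length (filter P? xs) ≡ sum (map (𝟙 ∘ P?) xs)
  length-filter≡sum P? [] = refl
  length-filter≡sum P? (x ∷ xs) with does (P? x)
  ... | true = cong suc (length-filter≡sum P? xs)
  ... | false = length-filter≡sum P? xs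

  sum-map-concatMap : ∀ {a b} {A : Set a} {B : Set b} (g : A → List B) (t : B → ℕ) xs →
    sum (map t (concatMap g xs)) ≡ sum (map (λ x → sum (map t (g x))) xs)
  sum-map-concatMap g t [] = refl
  sum-map-concatMap g t (x ∷ xs) = begin
    sum (map t (g x ++ concatMap g xs))
      ≡⟨ cong sum (map-++ t (g x) (concatMap g xs)) ⟩
    sum (map t (g x) ++ map t (concatMap g xs))
      ≡⟨ sum-++ (map t (g x)) _ ⟩
    sum (map t (g x)) + sum (map t (concatMap g xs))
      ≡⟨ cong (_+_ (sum (map t (g x)))) (sum-map-concatMap g t xs) ⟩
    sum (map t (g x)) + sum (map (λ x → sum (map t (g x))) xs)
      ∎

  sum-map-tabulate : ∀ {a} {A : Set a} {m} (f : Fin m → A) (t : A → ℕ) →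
    sum (map t (tabulate f)) ≡ ℕΣ.sum (t ∘ f)
  sum-map-tabulate {m = zero} f t = refl
  sum-map-tabulate {m = suc m} f t = cong (_+_ (t (f zero))) (sum-map-tabulate (f ∘ suc) t)

module WordCounting (q : ℕ) where
  open NaturalWordSum q
  open ListSums
  open ≡-Reasoning

  sum-map-allWords : ∀ {n} (t : Word q n → ℕ) → sum (map t (allWords q n)) ≡ ∑ʷ t
  sum-map-allWords {zero} t = ℕP.+-identityʳ (t [])
  sum-map-allWords {suc n} t = begin
    sum (map t (allWords q (suc n)))
      ≡⟨ sum-map-concatMap (λ a → map (a ∷_) (allWords q n)) t (allFin q) ⟩
    sum (map (λ a → sum (map t (map (a ∷_) (allWords q n)))) (allFin q))
      ≡⟨ sum-map-tabulate (λ a → a) (λ a → sum (map t (map (a ∷_) (allWords q n)))) ⟩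
    ℕΣ.sum (λ a → sum (map t (map (a ∷_) (allWords q n))))
      ≡⟨ ℕΣ.sum-cong-≗ per-letter ⟩
    ℕΣ.sum (λ a → ∑ʷ (λ y → t (a ∷ y)))  ∎
    where
    per-letter : ∀ a → sum (map t (map (a ∷_) (allWords q n))) ≡ ∑ʷ (λ y → t (a ∷ y))
    per-letter a =
      trans (cong sum (sym (map-∘ (allWords q n)))) (sum-map-allWords (λ y → t (a ∷ y)))

  count≡∑ʷ : ∀ {n p} {P : Pred (Word q n) p} (P? : Decidable P) →
    length (filter P? (allWords q n)) ≡ ∑ʷ (𝟙 ∘ P?)
  count≡∑ʷ P? = trans (length-filter≡sum P? (allWords q _)) (sum-map-allWords (𝟙 ∘ P?))

module HammingDistance (q : ℕ) where

  dist-refl : ∀ {n} (x : Word q n) → dist x x ≡ 0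
  dist-refl [] = refl
  dist-refl (a ∷ x) with a ≟ᶠ a
  ... | yes _ = dist-refl x
  ... | no a≢a = ⊥-elim (a≢a refl)

  dist-∷-≡ : ∀ {n} a (x y : Word q n) → dist (a ∷ x) (a ∷ y) ≡ dist x y
  dist-∷-≡ a x y with a ≟ᶠ a
  ... | yes _ = refl
  ... | no a≢a = ⊥-elim (a≢a refl)

  dist-∷-≢ : ∀ {n a b} → a ≢ b → (x y : Word q n) →
    dist (a ∷ x) (b ∷ y) ≡ suc (dist x y)
  dist-∷-≢ {a = a} {b} a≢b x y with a ≟ᶠ b
  ... | yes a≡b = ⊥-elim (a≢b a≡b)
  ... | no _ = refl

  edge-invariant⇒constant : ∀ {n ℓ} {A : Set ℓ} (f : Word q n → A) →
    (∀ x y → dist x y ≡ 1 → f x ≡ f y) → ∀ x y → f x ≡ f y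
  edge-invariant⇒constant f invariant [] [] = refl
  edge-invariant⇒constant f invariant (a ∷ x) (b ∷ y) = trans change-first-letter
    (edge-invariant⇒constant (λ z → f (b ∷ z))
      (λ x y d≡1 → invariant (b ∷ x) (b ∷ y) (trans (dist-∷-≡ b x y) d≡1)) x y)
    where
    change-first-letter : f (a ∷ x) ≡ f (b ∷ x)
    change-first-letter with a ≟ᶠ b
    ... | yes refl = refl
    ... | no a≢b =
      invariant (a ∷ x) (b ∷ x) (trans (dist-∷-≢ a≢b x x) (cong suc (dist-refl x)))

module HammingGraph (p : ℕ) where
  open import Data.Integer using (_+_; _-_; -_; _*_)
  open CommutativeSemigroupProperties ℤP.*-commutativeSemigroup using (x∙yz≈y∙xz)
  open SemiringSum ℤP.+-*-semiring
  open IntegerFinSum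
  open ≡-Reasoning

  q : ℕ
  q = suc p

  open WordSum ℤP.+-*-semiring q public
  module ℕʷ = NaturalWordSum q

  ∑ʷ-δ : ∀ {n} (x : Word q n) (k : Word q n → ℤ) →
    ∑ʷ (λ y → + 𝟙 (dist x y ≟ⁿ 0) * k y) ≡ k x
  ∑ʷ-δ [] k = ℤP.*-identityˡ (k [])
  ∑ʷ-δ {suc n} (a ∷ x) k = trans (sum-cong-≗ per-letter) (∑-δ a (λ b → k (b ∷ x)))
    where
    per-letter : ∀ b → ∑ʷ (λ y → + 𝟙 (dist (a ∷ x) (b ∷ y) ≟ⁿ 0) * k (b ∷ y))
                       ≡ + 𝟙 (a ≟ᶠ b) * k (b ∷ x)
    per-letter b with a ≟ᶠ b
    ... | yes refl = trans (∑ʷ-δ x (λ y → k (a ∷ y))) (sym (ℤP.*-identityˡ _))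
    ... | no _ = ∑ʷ-zero {n}

  pos-∑ʷ : ∀ {n} (t : Word q n → ℕ) → + ℕʷ.∑ʷ t ≡ ∑ʷ (λ y → + t y)
  pos-∑ʷ {zero} t = refl
  pos-∑ʷ {suc n} t = trans (pos-∑ (λ a → ℕʷ.∑ʷ (λ y → t (a ∷ y))))
    (sum-cong-≗ (λ a → pos-∑ʷ (λ y → t (a ∷ y))))

  nbrSum : ∀ {n} → (Word q n → ℤ) → Word q n → ℤ
  nbrSum h x = ∑ʷ (λ y → + 𝟙 (dist x y ≟ⁿ 1) * h y)

  marginal : ∀ {n} → (Word q (suc n) → ℤ) → Word q n → ℤ
  marginal h x = ∑[ b < q ] h (b ∷ x)

  slice : ∀ {n} → (Word q (suc n) → ℤ) → Fin q → Word q n → ℤ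
  slice h a y = h (a ∷ y)

  degree : ℕ → ℤ
  degree n = + (n ℕ.* p)

  degree-suc : ∀ n → degree (suc n) ≡ degree n + + p
  degree-suc n = trans (cong +_ (ℕP.+-comm p (n ℕ.* p))) (ℤP.pos-+ (n ℕ.* p) p)

  -- A neighbour of a ∷ x either keeps the letter a, and is a neighbour of x in the slice,
  -- or replaces a by some b ≠ a and keeps x.
  nbrSum-∷ : ∀ {n} (h : Word q (suc n) → ℤ) a x →
    nbrSum h (a ∷ x) ≡ nbrSum (slice h a) x - h (a ∷ x) + marginal h x
  nbrSum-∷ h a x = begin
    nbrSum h (a ∷ x)
      ≡⟨ sum-cong-≗ per-letter ⟩
    ∑[ b < q ] (h (b ∷ x) + + 𝟙 (a ≟ᶠ b) * (N b - h (b ∷ x)))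
      ≡⟨ ∑-distrib-+ (λ b → h (b ∷ x)) (λ b → + 𝟙 (a ≟ᶠ b) * (N b - h (b ∷ x))) ⟩
    marginal h x + ∑[ b < q ] (+ 𝟙 (a ≟ᶠ b) * (N b - h (b ∷ x)))
      ≡⟨ cong (_+_ (marginal h x)) (∑-δ a (λ b → N b - h (b ∷ x))) ⟩
    marginal h x + (N a - h (a ∷ x))
      ≡⟨ ℤP.+-comm (marginal h x) _ ⟩
    N a - h (a ∷ x) + marginal h x ∎
    where
    N : Fin q → ℤ
    N b = nbrSum (slice h b) x
    v≡u+1[v-u] : ∀ v u → v ≡ u + 1ℤ * (v - u)
    v≡u+1[v-u] = solve-∀
    per-letter : ∀ b → ∑ʷ (λ y → + 𝟙 (dist (a ∷ x) (b ∷ y) ≟ⁿ 1) * h (b ∷ y))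
                       ≡ h (b ∷ x) + + 𝟙 (a ≟ᶠ b) * (N b - h (b ∷ x))
    per-letter b with a ≟ᶠ b
    ... | yes refl = v≡u+1[v-u] (N a) (h (a ∷ x))
    ... | no _ = trans (∑ʷ-δ x (slice h b)) (sym (ℤP.+-identityʳ _))

  nbrSum-cong : ∀ {n} {f g : Word q n → ℤ} → (∀ y → f y ≡ g y) →
    ∀ x → nbrSum f x ≡ nbrSum g x
  nbrSum-cong f≡g x = ∑ʷ-cong (λ y → cong (+ 𝟙 (dist x y ≟ⁿ 1) *_) (f≡g y))

  nbrSum-+ : ∀ {n} (f g : Word q n → ℤ) x →
    nbrSum (λ y → f y + g y) x ≡ nbrSum f x + nbrSum g x
  nbrSum-+ f g x = trans (∑ʷ-cong (λ y → ℤP.*-distribˡ-+ (+ 𝟙 (dist x y ≟ⁿ 1)) (f y) (g y)))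
    (∑ʷ-distrib-+ (λ y → + 𝟙 (dist x y ≟ⁿ 1) * f y) (λ y → + 𝟙 (dist x y ≟ⁿ 1) * g y))

  nbrSum-*ˡ : ∀ {n} k (f : Word q n → ℤ) x → nbrSum (λ y → k * f y) x ≡ k * nbrSum f x
  nbrSum-*ˡ k f x = trans (∑ʷ-cong (λ y → x∙yz≈y∙xz (+ 𝟙 (dist x y ≟ⁿ 1)) k (f y)))
    (*-distribˡ-∑ʷ k (λ y → + 𝟙 (dist x y ≟ⁿ 1) * f y))

  nbrSum-− : ∀ {n} (f g : Word q n → ℤ) x →
    nbrSum (λ y → f y - g y) x ≡ nbrSum f x - nbrSum g x
  nbrSum-− f g x = begin
    nbrSum (λ y → f y - g y) x
      ≡⟨ nbrSum-cong (λ y → cong (_+_ (f y)) (sym (ℤP.-1*i≡-i (g y)))) x ⟩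
    nbrSum (λ y → f y + -1ℤ * g y) x
      ≡⟨ nbrSum-+ f (λ y → -1ℤ * g y) x ⟩
    nbrSum f x + nbrSum (λ y → -1ℤ * g y) x
      ≡⟨ cong (_+_ (nbrSum f x)) (nbrSum-*ˡ -1ℤ g x) ⟩
    nbrSum f x + -1ℤ * nbrSum g x
      ≡⟨ cong (_+_ (nbrSum f x)) (ℤP.-1*i≡-i (nbrSum g x)) ⟩
    nbrSum f x - nbrSum g x
      ∎

  nbrSum-marginal : ∀ {n} (h : Word q (suc n) → ℤ) x →
    nbrSum (marginal h) x ≡ ∑[ b < q ] nbrSum (slice h b) x
  nbrSum-marginal h x =
    trans (∑ʷ-cong (λ y → *-distribˡ-sum (+ 𝟙 (dist x y ≟ⁿ 1)) (λ b → h (b ∷ y))))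
    (∑ʷ-comm-∑ (λ b y → + 𝟙 (dist x y ≟ⁿ 1) * h (b ∷ y)))

  nbrSum-1≡degree : ∀ {n} (x : Word q n) → nbrSum (λ _ → 1ℤ) x ≡ degree n
  nbrSum-1≡degree [] = refl
  nbrSum-1≡degree {suc n} (a ∷ x) = begin
    nbrSum (λ _ → 1ℤ) (a ∷ x)
      ≡⟨ nbrSum-∷ (λ _ → 1ℤ) a x ⟩
    nbrSum (λ _ → 1ℤ) x - 1ℤ + ∑[ b < q ] 1ℤ
      ≡⟨ cong₂ (λ d s → d - 1ℤ + s) (nbrSum-1≡degree x) (∑-const {q} 1ℤ) ⟩
    degree n - 1ℤ + + q * 1ℤ
      ≡⟨ cong (λ s → degree n - 1ℤ + s * 1ℤ) (ℤP.pos-+ 1 p) ⟩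
    degree n - 1ℤ + (1ℤ + + p) * 1ℤ
      ≡⟨ d-1+[1+p]1≡d+p (degree n) (+ p) ⟩
    degree n + + p
      ≡⟨ degree-suc n ⟨
    degree (suc n)
      ∎
    where d-1+[1+p]1≡d+p : ∀ d p → d - 1ℤ + (1ℤ + p) * 1ℤ ≡ d + p
          d-1+[1+p]1≡d+p = solve-∀

module Eigenfunctions (p : ℕ) where
  open import Data.Integer using (_+_; _-_; -_; _*_)
  open HammingGraph p
  open SemiringSum ℤP.+-*-semiring
  open IntegerFinSum
  open NaturalFinSum
  open PowerBounds

  record IsEigen {n} (θ : ℤ) (h : Word q n → ℤ) : Set where
    constructor eigen
    field nbrSum≡ : ∀ x → nbrSum h x ≡ θ * h x
  open IsEigen

  slice-nbrSum : ∀ {n θ} {h : Word q (suc n) → ℤ} → IsEigen θ h → ∀ a x →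
    nbrSum (slice h a) x ≡ (θ + 1ℤ) * h (a ∷ x) - marginal h x
  slice-nbrSum {θ = θ} {h} eig a x = begin
    N                         ≡⟨ v≡[v-u+m]+u-m N u m ⟩
    (N - u + m) + u - m       ≡⟨ cong (λ t → t + u - m) (sym (nbrSum-∷ h a x)) ⟩
    nbrSum h (a ∷ x) + u - m  ≡⟨ cong (λ t → t + u - m) (nbrSum≡ eig (a ∷ x)) ⟩
    θ * u + u - m             ≡⟨ θu+u-m≡[θ+1]u-m θ u m ⟩
    (θ + 1ℤ) * u - m          ∎
    where
    open ≡-Reasoning
    N u m : ℤ
    N = nbrSum (slice h a) x
    u = h (a ∷ x)
    m = marginal h x
    v≡[v-u+m]+u-m : ∀ v u m → v ≡ (v - u + m) + u - m
    v≡[v-u+m]+u-m = solve-∀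
    θu+u-m≡[θ+1]u-m : ∀ θ u m → θ * u + u - m ≡ (θ + 1ℤ) * u - m
    θu+u-m≡[θ+1]u-m = solve-∀

  marginal-isEigen : ∀ {n θ} {h : Word q (suc n) → ℤ} → IsEigen θ h →
    IsEigen (θ - + p) (marginal h)
  marginal-isEigen {θ = θ} {h} eig = eigen eigen-equation
    where
    [θ+1]m+[1+p][-m]≡[θ-p]m : ∀ θ p m → (θ + 1ℤ) * m + (1ℤ + p) * - m ≡ (θ - p) * m
    [θ+1]m+[1+p][-m]≡[θ-p]m = solve-∀
    eigen-equation : ∀ x → nbrSum (marginal h) x ≡ (θ - + p) * marginal h x
    eigen-equation x = begin
      nbrSum (marginal h) x
        ≡⟨ nbrSum-marginal h x ⟩
      ∑[ b < q ] nbrSum (slice h b) x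
        ≡⟨ sum-cong-≗ (λ b → slice-nbrSum eig b x) ⟩
      ∑[ b < q ] ((θ + 1ℤ) * h (b ∷ x) + - m)
        ≡⟨ ∑-distrib-+ (λ b → (θ + 1ℤ) * h (b ∷ x)) (λ _ → - m) ⟩
      ∑[ b < q ] ((θ + 1ℤ) * h (b ∷ x)) + ∑[ b < q ] (- m)
        ≡⟨ cong₂ _+_ (sym (*-distribˡ-sum (θ + 1ℤ) (λ b → h (b ∷ x)))) (∑-const {q} (- m)) ⟩
      (θ + 1ℤ) * m + + q * - m
        ≡⟨ cong (λ c → (θ + 1ℤ) * m + c * - m) (ℤP.pos-+ 1 p) ⟩
      (θ + 1ℤ) * m + (1ℤ + + p) * - m
        ≡⟨ [θ+1]m+[1+p][-m]≡[θ-p]m θ (+ p) m ⟩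
      (θ - + p) * m
        ∎
      where
      open ≡-Reasoning
      m : ℤ
      m = marginal h x

  slice-isEigen : ∀ {n θ} {h : Word q (suc n) → ℤ} → IsEigen θ h → (∀ x → marginal h x ≡ 0ℤ) →
    ∀ a → IsEigen (θ + 1ℤ) (slice h a)
  slice-isEigen {θ = θ} {h} eig marginal≡0 a = eigen λ x → trans (slice-nbrSum eig a x)
    (trans (cong (_-_ ((θ + 1ℤ) * h (a ∷ x))) (marginal≡0 x)) (ℤP.+-identityʳ _))

  eigen-∑ʷ : ∀ n {θ} {h : Word q n → ℤ} → IsEigen θ h → (degree n - θ) * ∑ʷ h ≡ 0ℤ
  eigen-∑ʷ zero {θ} {h} eig = trans ([0-θ]v≡-[θv] θ (h [])) (cong -_ (sym (nbrSum≡ eig [])))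
    where [0-θ]v≡-[θv] : ∀ θ v → (0ℤ - θ) * v ≡ - (θ * v)
          [0-θ]v≡-[θv] = solve-∀
  eigen-∑ʷ (suc n) {θ} {h} eig = begin
    (degree (suc n) - θ) * ∑ʷ h
      ≡⟨ cong₂ _*_ shift (sym (∑ʷ-comm-∑ (λ b y → h (b ∷ y)))) ⟩
    (degree n - (θ - + p)) * ∑ʷ (marginal h)
      ≡⟨ eigen-∑ʷ n (marginal-isEigen eig) ⟩
    0ℤ
      ∎
    where
    open ≡-Reasoning
    d+p-θ≡d-[θ-p] : ∀ d p θ → d + p - θ ≡ d - (θ - p)
    d+p-θ≡d-[θ-p] = solve-∀
    shift : degree (suc n) - θ ≡ degree n - (θ - + p)
    shift = trans (cong (_- θ) (degree-suc n)) (d+p-θ≡d-[θ-p] (degree n) (+ p) θ)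

  eigen-∑ʷ≡0 : ∀ n k {h : Word q n → ℤ} → IsEigen (degree n - + k) h → 0 < k → ∑ʷ h ≡ 0ℤ
  eigen-∑ʷ≡0 n k {h} eig 0<k = fromInj₂ (λ k≡0 → ⊥-elim (ℕP.<⇒≢ 0<k (sym (ℤP.+-injective k≡0))))
    (ℤP.i*j≡0⇒i≡0∨j≡0 (+ k) k∑h≡0)
    where
    k≡d-[d-k] : ∀ d k → k ≡ d - (d - k)
    k≡d-[d-k] = solve-∀
    k∑h≡0 : + k * ∑ʷ h ≡ 0ℤ
    k∑h≡0 = trans (cong (_* ∑ʷ h) (k≡d-[d-k] (degree n) (+ k))) (eigen-∑ʷ n eig)

  nonzero : ℤ → ℕ
  nonzero (+ zero) = 0
  nonzero _ = 1

  nonzero≡0⇒≡0 : ∀ v → nonzero v ≡ 0 → v ≡ 0ℤ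
  nonzero≡0⇒≡0 (+ zero) _ = refl

  nonzero≤1 : ∀ v → nonzero v ≤ 1
  nonzero≤1 (+ zero) = z≤n
  nonzero≤1 (+ suc _) = s≤s z≤n
  nonzero≤1 -[1+ _ ] = s≤s z≤n

  nonzero-+ : ∀ u v → nonzero (u + v) ≤ nonzero u ℕ.+ nonzero v
  nonzero-+ (+ zero) v = ℕP.≤-reflexive (cong nonzero (ℤP.+-identityˡ v))
  nonzero-+ u@(+ suc _) v = ℕP.≤-trans (nonzero≤1 (u + v)) (s≤s z≤n)
  nonzero-+ u@(-[1+ _ ]) v = ℕP.≤-trans (nonzero≤1 (u + v)) (s≤s z≤n)

  nonzero-∑ : ∀ {m} (u : Fin m → ℤ) → nonzero (∑[ b < m ] u b) ≤ ℕΣ.sum (nonzero ∘ u)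
  nonzero-∑ {zero} u = z≤n
  nonzero-∑ {suc m} u = ℕP.≤-trans (nonzero-+ (u zero) _)
    (ℕP.+-monoʳ-≤ (nonzero (u zero)) (nonzero-∑ (u ∘ suc)))

  support : ∀ {n} → (Word q n → ℤ) → ℕ
  support h = ℕʷ.∑ʷ (nonzero ∘ h)

  support≡0⇒≡0 : ∀ {n} (h : Word q n → ℤ) → support h ≡ 0 → ∀ x → h x ≡ 0ℤ
  support≡0⇒≡0 h supp≡0 x = nonzero≡0⇒≡0 (h x) (ℕʷ.∑ʷ≡0⇒≡0 (nonzero ∘ h) supp≡0 x)

  support-marginal≤ : ∀ {n} (h : Word q (suc n) → ℤ) → support (marginal h) ≤ support h
  support-marginal≤ h = ℕP.≤-trans (ℕʷ.∑ʷ-mono-≤ (λ x → nonzero-∑ (λ b → h (b ∷ x))))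
    (ℕP.≤-reflexive (ℕʷ.∑ʷ-comm-∑ (λ b x → nonzero (h (b ∷ x)))))

  -- If the marginal vanishes, the slice at a is minus the sum of the other slices.
  another-nonzero-slice : ∀ {n} (h : Word q (suc n) → ℤ) → (∀ x → marginal h x ≡ 0ℤ) →
    ∀ a → 0 < support (slice h a) → ∃ λ b → a ≢ b × 0 < support (slice h b)
  another-nonzero-slice {n} h marginal≡0 a 0<supp-a
    with any? (λ b → ¬? (a ≟ᶠ b) ×-dec (0 ℕP.<? support (slice h b)))
  ... | yes found = found
  ... | no none =
    ⊥-elim (ℕP.<⇒≢ 0<supp-a (sym (trans (ℕʷ.∑ʷ-cong slice-a≡0) (ℕʷ.∑ʷ-zero {n}))))
    where
    other≡0 : ∀ b → a ≢ b → ∀ y → h (b ∷ y) ≡ 0ℤ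
    other≡0 b a≢b = support≡0⇒≡0 (slice h b)
      (ℕP.n≤0⇒n≡0 (ℕP.≮⇒≥ (λ 0<supp-b → none (b , a≢b , 0<supp-b))))
    only-a : ∀ y b → h (b ∷ y) ≡ + 𝟙 (a ≟ᶠ b) * h (b ∷ y)
    only-a y b with a ≟ᶠ b
    ... | yes refl = sym (ℤP.*-identityˡ _)
    ... | no a≢b = other≡0 b a≢b y
    slice-a≡0 : ∀ y → nonzero (h (a ∷ y)) ≡ 0
    slice-a≡0 y = cong nonzero (trans (sym (∑-δ a (λ b → h (b ∷ y))))
      (trans (sym (sum-cong-≗ (only-a y))) (marginal≡0 y)))

  two-nonzero-slices : ∀ {n} (h : Word q (suc n) → ℤ) → (∀ x → marginal h x ≡ 0ℤ) →
    0 < support h →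
    ∃ λ a → ∃ λ b → a ≢ b × 0 < support (slice h a) × 0 < support (slice h b)
  two-nonzero-slices h marginal≡0 0<supp =
    let a , 0<supp-a = ∑-positive (support ∘ slice h) 0<supp
        b , a≢b , 0<supp-b = another-nonzero-slice h marginal≡0 a 0<supp-a
    in a , b , a≢b , 0<supp-a , 0<supp-b

  marginal-eigenvalue : ∀ n k → degree (suc n) - + k - + p ≡ degree n - + k
  marginal-eigenvalue n k =
    trans (cong (λ d → d - + k - + p) (degree-suc n)) (d+p-k-p≡d-k (degree n) (+ p) (+ k))
    where d+p-k-p≡d-k : ∀ d p k → d + p - k - p ≡ d - k
          d+p-k-p≡d-k = solve-∀

  slice-eigenvalue : ∀ n k → degree (suc n) - + (q ℕ.+ k) + 1ℤ ≡ degree n - + k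
  slice-eigenvalue n k = begin
    degree (suc n) - + (q ℕ.+ k) + 1ℤ
      ≡⟨ cong₂ (λ d s → d - s + 1ℤ) (degree-suc n) (ℤP.pos-+ q k) ⟩
    degree n + + p - (+ q + + k) + 1ℤ
      ≡⟨ cong (λ s → degree n + + p - (s + + k) + 1ℤ) (ℤP.pos-+ 1 p) ⟩
    degree n + + p - (1ℤ + + p + + k) + 1ℤ
      ≡⟨ d+p-[1+p+k]+1≡d-k (degree n) (+ p) (+ k) ⟩
    degree n - + k
      ∎
    where
    open ≡-Reasoning
    d+p-[1+p+k]+1≡d-k : ∀ d p k → d + p - (1ℤ + p + k) + 1ℤ ≡ d - k
    d+p-[1+p+k]+1≡d-k = solve-∀

  support-bound : ∀ n k (h : Word q n → ℤ) → IsEigen (degree n - + k) h → 0 < support h →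
    2 ^ k ≤ support h ^ q
  support-bound zero zero h _ 0<supp =
    subst (_≤ support h ^ q) (ℕP.^-zeroˡ q) (ℕP.^-monoˡ-≤ q 0<supp)
  support-bound zero (suc k) h eig 0<supp with ℤP.i*j≡0⇒i≡0∨j≡0 -[1+ k ] (sym (nbrSum≡ eig []))
  ... | inj₁ ()
  ... | inj₂ h≡0 = ⊥-elim (ℕP.<⇒≢ 0<supp (sym (cong nonzero h≡0)))
  support-bound (suc n) k h eig 0<supp with support (marginal h) ≟ⁿ 0
  ... | no supp≢0 = ℕP.≤-trans (support-bound n k (marginal h) marginal-eig (ℕP.n≢0⇒n>0 supp≢0))
    (ℕP.^-monoˡ-≤ q (support-marginal≤ h))
    where
    marginal-eig : IsEigen (degree n - + k) (marginal h)
    marginal-eig =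
      subst (λ θ → IsEigen θ (marginal h)) (marginal-eigenvalue n k) (marginal-isEigen eig)
  ... | yes supp≡0
    with two-nonzero-slices h (support≡0⇒≡0 (marginal h) supp≡0) 0<supp | ℕP.≤-total k q
  ... | a , b , a≢b , 0<supp-a , 0<supp-b | inj₁ k≤q =
    ℕP.≤-trans (2^k≤[x+y]^q k≤q 0<supp-a 0<supp-b)
    (ℕP.^-monoˡ-≤ q (two-terms≤∑ (support ∘ slice h) a≢b))
  ... | a , b , a≢b , 0<supp-a , 0<supp-b | inj₂ q≤k with ℕP.m≤n⇒∃[o]m+o≡n q≤k
  ... | k′ , refl = ℕP.≤-trans
    (2^[q+k]≤[x+y]^q q k′ (support (slice h a)) (support (slice h b))
      (slice-bound a 0<supp-a) (slice-bound b 0<supp-b))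
    (ℕP.^-monoˡ-≤ q (two-terms≤∑ (support ∘ slice h) a≢b))
    where
    slice-bound : ∀ c → 0 < support (slice h c) → 2 ^ k′ ≤ support (slice h c) ^ q
    slice-bound c = support-bound n k′ (slice h c)
      (subst (λ θ → IsEigen θ (slice h c)) (slice-eigenvalue n k′)
        (slice-isEigen eig (support≡0⇒≡0 (marginal h) supp≡0) c))

module PerfectColourings (p : ℕ) where
  open import Data.Integer using (_+_; _-_; _*_)
  open HammingGraph p
  open Eigenfunctions p
  open HammingDistance q
  open WordCounting q using (count≡∑ʷ)
  open PowerBounds

  𝟙-yes : ∀ {a} {P : Set a} (d : Dec P) → P → 𝟙 d ≡ 1
  𝟙-yes (yes _) _ = refl
  𝟙-yes (no ¬p) p = ⊥-elim (¬p p)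

  𝟙-×-dec : ∀ {a b} {P : Set a} {Q : Set b} (d : Dec P) (e : Dec Q) → 𝟙 (d ×-dec e) ≡ 𝟙 d ℕ.* 𝟙 e
  𝟙-×-dec d e with does d
  ... | true = sym (ℕP.+-identityʳ (𝟙 e))
  ... | false = refl

  χ₁ : Fin 2 → ℤ
  χ₁ u = + 𝟙 (u ≟ᶠ suc zero)

  χ : ∀ {n} → Coloring q n → Word q n → ℤ
  χ f x = χ₁ (f x)

  χ₁-complement : ∀ u → χ₁ u ≡ 1ℤ - + 𝟙 (u ≟ᶠ zero)
  χ₁-complement zero = refl
  χ₁-complement (suc zero) = refl

  nbrCount≡nbrSum : ∀ {n} (f : Coloring q n) x j →
    + nbrCount f x j ≡ nbrSum (λ y → + 𝟙 (f y ≟ᶠ j)) x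
  nbrCount≡nbrSum f x j = trans (cong +_ (count≡∑ʷ P?)) (trans (pos-∑ʷ (𝟙 ∘ P?)) (∑ʷ-cong 𝟙-P?))
    where
    P? : ∀ y → Dec (dist x y ≡ 1 × f y ≡ j)
    P? y = (dist x y ≟ⁿ 1) ×-dec (f y ≟ᶠ j)
    𝟙-P? : ∀ y → + 𝟙 (P? y) ≡ + 𝟙 (dist x y ≟ⁿ 1) * + 𝟙 (f y ≟ᶠ j)
    𝟙-P? y = trans (cong +_ (𝟙-×-dec (dist x y ≟ⁿ 1) (f y ≟ᶠ j)))
      (ℤP.pos-* (𝟙 (dist x y ≟ⁿ 1)) (𝟙 (f y ≟ᶠ j)))

  perfect⇒nbrSum-χ : ∀ {n b c} {f : Coloring q n} → IsPerfect2Coloring f (paramMatrix q n b c) →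
    ∀ x → nbrSum (χ f) x ≡ + b + (degree n - + (c ℕ.+ b)) * χ f x
  perfect⇒nbrSum-χ {n} {b} {c} {f} (_ , _ , counts) x with f x in fx
  ... | zero = begin
    nbrSum (χ f) x                         ≡⟨ nbrCount≡nbrSum f x (suc zero) ⟨
    + nbrCount f x (suc zero)              ≡⟨ cong +_ (counts x zero (suc zero) fx) ⟩
    + b                                    ≡⟨ b≡b+θ0 (+ b) (degree n - + (c ℕ.+ b)) ⟩
    + b + (degree n - + (c ℕ.+ b)) * 0ℤ    ∎
    where
    open ≡-Reasoning
    b≡b+θ0 : ∀ b θ → b ≡ b + θ * 0ℤ
    b≡b+θ0 = solve-∀
  ... | suc zero = begin
    nbrSum (χ f) x
      ≡⟨ nbrSum-cong (λ y → χ₁-complement (f y)) x ⟩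
    nbrSum (λ y → 1ℤ - + 𝟙 (f y ≟ᶠ zero)) x
      ≡⟨ nbrSum-− (λ _ → 1ℤ) (λ y → + 𝟙 (f y ≟ᶠ zero)) x ⟩
    nbrSum (λ _ → 1ℤ) x - nbrSum (λ y → + 𝟙 (f y ≟ᶠ zero)) x
      ≡⟨ cong₂ _-_ (nbrSum-1≡degree x) (sym (nbrCount≡nbrSum f x zero)) ⟩
    degree n - + nbrCount f x zero
      ≡⟨ cong (λ m → degree n - + m) (counts x (suc zero) zero fx) ⟩
    degree n - + c
      ≡⟨ d-c≡b+[d-[c+b]]1 (degree n) (+ c) (+ b) ⟩
    + b + (degree n - (+ c + + b)) * 1ℤ
      ≡⟨ cong (λ s → + b + (degree n - s) * 1ℤ) (ℤP.pos-+ c b) ⟨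
    + b + (degree n - + (c ℕ.+ b)) * 1ℤ
      ∎
    where
    open ≡-Reasoning
    d-c≡b+[d-[c+b]]1 : ∀ d c b → d - c ≡ b + (d - (c + b)) * 1ℤ
    d-c≡b+[d-[c+b]]1 = solve-∀

  difference-isEigen : ∀ {n b c} {f g : Coloring q n} →
    IsPerfect2Coloring f (paramMatrix q n b c) → IsPerfect2Coloring g (paramMatrix q n b c) →
    IsEigen (degree n - + (c ℕ.+ b)) (λ x → χ f x - χ g x)
  difference-isEigen {n} {b} {c} {f} {g} pf pg = eigen λ x → begin
    nbrSum (λ y → χ f y - χ g y) x
      ≡⟨ nbrSum-− (χ f) (χ g) x ⟩
    nbrSum (χ f) x - nbrSum (χ g) x
      ≡⟨ cong₂ _-_ (perfect⇒nbrSum-χ pf x) (perfect⇒nbrSum-χ pg x) ⟩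
    (+ b + θ * χ f x) - (+ b + θ * χ g x)
      ≡⟨ [b+θu]-[b+θv]≡θ[u-v] (+ b) θ (χ f x) (χ g x) ⟩
    θ * (χ f x - χ g x)
      ∎
    where
    open ≡-Reasoning
    θ : ℤ
    θ = degree n - + (c ℕ.+ b)
    [b+θu]-[b+θv]≡θ[u-v] : ∀ b θ u v → (b + θ * u) - (b + θ * v) ≡ θ * (u - v)
    [b+θu]-[b+θv]≡θ[u-v] = solve-∀

  perfect⇒1≤M[fx,fy] : ∀ {n} {f : Coloring q n} {M} → IsPerfect2Coloring f M →
    ∀ {x y} → dist x y ≡ 1 → 1 ≤ M (f x) (f y)
  perfect⇒1≤M[fx,fy] {f = f} (_ , _ , counts) {x} {y} d≡1 =
    subst (1 ≤_) (trans (sym (count≡∑ʷ P?)) (counts x (f x) (f y) refl))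
      (subst (_≤ ℕʷ.∑ʷ (𝟙 ∘ P?)) (𝟙-yes (P? y) (d≡1 , refl)) (ℕʷ.term≤∑ʷ (𝟙 ∘ P?) y))
    where
    P? : ∀ z → Dec (dist x z ≡ 1 × f z ≡ f y)
    P? z = (dist x z ≟ⁿ 1) ×-dec (f z ≟ᶠ f y)

  -- For b + c = 0 every edge would be monochromatic, and the connected graph H(n,q) would have
  -- a single colour.
  perfect⇒0<c+b : ∀ {n b c} {f : Coloring q n} → IsPerfect2Coloring f (paramMatrix q n b c) →
    0 < c ℕ.+ b
  perfect⇒0<c+b {n} {b} {c} {f} pf@((x₀ , fx₀≡0) , (x₁ , fx₁≡1) , _) = ℕP.n≢0⇒n>0 λ c+b≡0 →
    0≢1 (trans (sym fx₀≡0) (trans (edge-invariant⇒constant f (monochromatic c+b≡0) x₀ x₁) fx₁≡1))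
    where
    0≢1 : zero ≢ suc zero
    0≢1 ()
    monochromatic : c ℕ.+ b ≡ 0 → ∀ x y → dist x y ≡ 1 → f x ≡ f y
    monochromatic c+b≡0 x y d≡1 with f x | f y | perfect⇒1≤M[fx,fy] pf {x} {y} d≡1
    ... | zero | zero | _ = refl
    ... | suc zero | suc zero | _ = refl
    ... | zero | suc zero | 1≤b = ⊥-elim (ℕP.n≮0 (subst (1 ≤_) (ℕP.m+n≡0⇒n≡0 c c+b≡0) 1≤b))
    ... | suc zero | zero | 1≤c = ⊥-elim (ℕP.n≮0 (subst (1 ≤_) (ℕP.m+n≡0⇒m≡0 c c+b≡0) 1≤c))

  𝟙₁₀ : Fin 2 → Fin 2 → ℕ
  𝟙₁₀ u v = 𝟙 ((u ≟ᶠ suc zero) ×-dec (v ≟ᶠ zero))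

  diffSize≡∑ʷ : ∀ {n} (f g : Coloring q n) → diffSize f g ≡ ℕʷ.∑ʷ (λ x → 𝟙₁₀ (f x) (g x))
  diffSize≡∑ʷ f g = count≡∑ʷ (λ x → (f x ≟ᶠ suc zero) ×-dec (g x ≟ᶠ zero))

  𝟙₁₀≡χ₁-χ₁+𝟙₁₀ : ∀ u v → + 𝟙₁₀ u v ≡ (χ₁ u - χ₁ v) + + 𝟙₁₀ v u
  𝟙₁₀≡χ₁-χ₁+𝟙₁₀ zero zero = refl
  𝟙₁₀≡χ₁-χ₁+𝟙₁₀ zero (suc zero) = refl
  𝟙₁₀≡χ₁-χ₁+𝟙₁₀ (suc zero) zero = refl
  𝟙₁₀≡χ₁-χ₁+𝟙₁₀ (suc zero) (suc zero) = refl

  nonzero[χ₁-χ₁]≡𝟙₁₀+𝟙₁₀ : ∀ u v → nonzero (χ₁ u - χ₁ v) ≡ 𝟙₁₀ u v ℕ.+ 𝟙₁₀ v u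
  nonzero[χ₁-χ₁]≡𝟙₁₀+𝟙₁₀ zero zero = refl
  nonzero[χ₁-χ₁]≡𝟙₁₀+𝟙₁₀ zero (suc zero) = refl
  nonzero[χ₁-χ₁]≡𝟙₁₀+𝟙₁₀ (suc zero) zero = refl
  nonzero[χ₁-χ₁]≡𝟙₁₀+𝟙₁₀ (suc zero) (suc zero) = refl

  χ₁-χ₁≡0⇒≡ : ∀ u v → χ₁ u - χ₁ v ≡ 0ℤ → u ≡ v
  χ₁-χ₁≡0⇒≡ zero zero _ = refl
  χ₁-χ₁≡0⇒≡ zero (suc zero) ()
  χ₁-χ₁≡0⇒≡ (suc zero) zero ()
  χ₁-χ₁≡0⇒≡ (suc zero) (suc zero) _ = refl

  diffSize-balanced : ∀ {n} (f g : Coloring q n) → ∑ʷ (λ x → χ f x - χ g x) ≡ 0ℤ →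
    diffSize f g ≡ diffSize g f
  diffSize-balanced f g ∑h≡0 = ℤP.+-injective (begin
    + diffSize f g
      ≡⟨ cong +_ (diffSize≡∑ʷ f g) ⟩
    + ℕʷ.∑ʷ (λ x → 𝟙₁₀ (f x) (g x))
      ≡⟨ pos-∑ʷ (λ x → 𝟙₁₀ (f x) (g x)) ⟩
    ∑ʷ (λ x → + 𝟙₁₀ (f x) (g x))
      ≡⟨ ∑ʷ-cong (λ x → 𝟙₁₀≡χ₁-χ₁+𝟙₁₀ (f x) (g x)) ⟩
    ∑ʷ (λ x → (χ f x - χ g x) + + 𝟙₁₀ (g x) (f x))
      ≡⟨ ∑ʷ-distrib-+ (λ x → χ f x - χ g x) (λ x → + 𝟙₁₀ (g x) (f x)) ⟩
    ∑ʷ (λ x → χ f x - χ g x) + ∑ʷ (λ x → + 𝟙₁₀ (g x) (f x))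
      ≡⟨ cong₂ _+_ ∑h≡0 (sym (pos-∑ʷ (λ x → 𝟙₁₀ (g x) (f x)))) ⟩
    0ℤ + + ℕʷ.∑ʷ (λ x → 𝟙₁₀ (g x) (f x))
      ≡⟨ ℤP.+-identityˡ _ ⟩
    + ℕʷ.∑ʷ (λ x → 𝟙₁₀ (g x) (f x))
      ≡⟨ cong +_ (diffSize≡∑ʷ g f) ⟨
    + diffSize g f
      ∎)
    where open ≡-Reasoning

  support-χ-difference : ∀ {n} (f g : Coloring q n) →
    support (λ x → χ f x - χ g x) ≡ diffSize f g ℕ.+ diffSize g f
  support-χ-difference f g = begin
    support (λ x → χ f x - χ g x)
      ≡⟨ ℕʷ.∑ʷ-cong (λ x → nonzero[χ₁-χ₁]≡𝟙₁₀+𝟙₁₀ (f x) (g x)) ⟩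
    ℕʷ.∑ʷ (λ x → 𝟙₁₀ (f x) (g x) ℕ.+ 𝟙₁₀ (g x) (f x))
      ≡⟨ ℕʷ.∑ʷ-distrib-+ (λ x → 𝟙₁₀ (f x) (g x)) (λ x → 𝟙₁₀ (g x) (f x)) ⟩
    ℕʷ.∑ʷ (λ x → 𝟙₁₀ (f x) (g x)) ℕ.+ ℕʷ.∑ʷ (λ x → 𝟙₁₀ (g x) (f x))
      ≡⟨ cong₂ ℕ._+_ (diffSize≡∑ʷ f g) (diffSize≡∑ʷ g f) ⟨
    diffSize f g ℕ.+ diffSize g f
      ∎
    where open ≡-Reasoning

  0<support-χ-difference : ∀ {n} (f g : Coloring q n) → ¬ (∀ x → f x ≡ g x) →
    0 < support (λ x → χ f x - χ g x)
  0<support-χ-difference f g f≢g = ℕP.n≢0⇒n>0 λ supp≡0 →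
    f≢g (λ x → χ₁-χ₁≡0⇒≡ (f x) (g x) (support≡0⇒≡0 _ supp≡0 x))

  component-bound : ∀ {n} b c (f g : Coloring q n) →
    IsPerfect2Coloring f (paramMatrix q n b c) → IsPerfect2Coloring g (paramMatrix q n b c) →
    ¬ (∀ x → f x ≡ g x) → 2 ^ (c ℕ.+ b) ≤ 2 ^ q ℕ.* diffSize f g ^ q
  component-bound {n} b c f g pf pg f≢g = begin
    2 ^ (c ℕ.+ b)                          ≤⟨ support-bound n (c ℕ.+ b) h eig 0<supp ⟩
    support h ^ q                          ≡⟨ cong (_^ q) (support-χ-difference f g) ⟩
    (diffSize f g ℕ.+ diffSize g f) ^ q    ≡⟨ cong (λ s → (diffSize f g ℕ.+ s) ^ q) balanced ⟨
    (diffSize f g ℕ.+ diffSize f g) ^ q    ≡⟨ [m+m]^k≡2^k*m^k (diffSize f g) q ⟩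
    2 ^ q ℕ.* diffSize f g ^ q             ∎
    where
    open ℕP.≤-Reasoning
    h : Word q n → ℤ
    h x = χ f x - χ g x
    eig : IsEigen (degree n - + (c ℕ.+ b)) h
    eig = difference-isEigen pf pg
    0<supp : 0 < support h
    0<supp = 0<support-χ-difference f g f≢g
    balanced : diffSize f g ≡ diffSize g f
    balanced = diffSize-balanced f g (eigen-∑ʷ≡0 n (c ℕ.+ b) eig (perfect⇒0<c+b pf))

open import Data.Nat using (_+_; _*_; _∸_)

corollary2 : (q n : ℕ) → 2 ≤ q → 1 ≤ n →
    ((b c : ℕ) (f g : Coloring q n) →
    IsPerfect2Coloring f (paramMatrix q n b c) →
    IsPerfect2Coloring g (paramMatrix q n b c) →
    ¬ (∀ x → f x ≡ g x) →
    2 ^ (c + b) ≤ 2 ^ q * diffSize f g ^ q)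
    ×
    ((C₁ C₂ : Coloring q n) →
    Is1PerfectCode C₁ → Is1PerfectCode C₂ →
    ¬ (∀ x → C₁ x ≡ C₂ x) →
    2 ^ (n * (q ∸ 1) + 1) ≤ 2 ^ q * diffSize C₁ C₂ ^ q)
corollary2 zero n () _
corollary2 (suc p) n _ _ = component-bound , component-bound 1 (n * p)
  where open PerfectColourings p
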